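{- Let $\ell\geq2$, let $G$ be a graph with girth $2\ell+1$ and no odd hole of length at least $2\ell+3$, and let $C$ be an odd hole of $G$. If a jump $P$ over $C$ is not local, then the induced subgraph $G[V(C\cup P)]$ contains a short jump over $C$.
   Context: Graphs are finite and simple; $P^*$ denotes the set of internal vertices of a path $P$. A hole is an induced cycle of length at least four; odd according to its length. Let $C$ be an odd hole, $s,t\in V(C)$ nonadjacent, and $Q_1,Q_2$ the two internally disjoint $(s,t)$-paths of $C$. An induced $(s,t)$-path $P$ with $V(P^*)\cap V(C)=\emptyset$ is a jump over $C$. $P$ is local if, for some $i\in\{1,2\}$, some vertex of $Q_i^*$ has a neighbour in $P^*$ and no vertex of $Q_{3-i}^*$ has a neighbour in $P^*$. $P$ is a short jump if no vertex of $Q_1^*\cup Q_2^*$ has a neighbour in $P^*$. -}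

module Defs where

open import Data.Nat using (ℕ; zero; suc; _+_; _*_; _≤_; _<_)
open import Data.Nat.Properties using ()
open import Data.Fin using (Fin; toℕ; fromℕ) renaming (zero to fz)
open import Data.Bool using (Bool; T)
open import Data.Product using (Σ; ∃; ∃-syntax; _×_; _,_)
open import Data.Sum using (_⊎_)
open import Relation.Nullary using (¬_)
open import Relation.Binary.PropositionalEquality using (_≡_; _≢_)
open import Function.Definitions using (Injective)

record Graph (n : ℕ) : Set where
  field
    adj    : Fin n → Fin n → Bool
    sym    : ∀ u v → adj u v ≡ adj v u
    irrefl : ∀ u → ¬ T (adj u u)

Adj : ∀ {n} → Graph n → Fin n → Fin n → Set
Adj G u v = T (Graph.adj G u v)

CSucc : (k : ℕ) → Fin k → Fin k → Set
CSucc k i j = (suc (toℕ i) ≡ toℕ j) ⊎ ((suc (toℕ i) ≡ k) × (toℕ j ≡ 0))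

CycAdj : (k : ℕ) → Fin k → Fin k → Set
CycAdj k i j = CSucc k i j ⊎ CSucc k j i

record IsCycle {n} (G : Graph n) (k : ℕ) (c : Fin k → Fin n) : Set where
  field
    length≥3 : 3 ≤ k
    inj      : Injective _≡_ _≡_ c
    edges    : ∀ i j → CSucc k i j → Adj G (c i) (c j)

HasGirth : ∀ {n} → Graph n → ℕ → Set
HasGirth {n} G g =
  (Σ (Fin g → Fin n) λ c → IsCycle G g c) ×
  (∀ k → k < g → (c : Fin k → Fin n) → ¬ IsCycle G k c)

record IsHole {n} (G : Graph n) (k : ℕ) (c : Fin k → Fin n) : Set where
  field
    length≥4 : 4 ≤ k
    inj      : Injective _≡_ _≡_ c
    edges    : ∀ i j → CycAdj k i j → Adj G (c i) (c j)
    induced  : ∀ i j → Adj G (c i) (c j) → CycAdj k i j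

Odd : ℕ → Set
Odd k = Σ ℕ λ r → k ≡ suc (2 * r)

IsOddHole : ∀ {n} → Graph n → (k : ℕ) → (Fin k → Fin n) → Set
IsOddHole G k c = IsHole G k c × Odd k

Consec : ∀ {m} → Fin m → Fin m → Set
Consec i j = (suc (toℕ i) ≡ toℕ j) ⊎ (suc (toℕ j) ≡ toℕ i)

record IsInducedPath {n} (G : Graph n) (m : ℕ) (p : Fin (suc m) → Fin n) : Set where
  field
    inj     : Injective _≡_ _≡_ p
    edges   : ∀ i j → Consec i j → Adj G (p i) (p j)
    induced : ∀ i j → Adj G (p i) (p j) → Consec i j

Internal : (m : ℕ) → Fin (suc m) → Set
Internal m i = (toℕ i ≢ 0) × (toℕ i ≢ m)

-- The two (s,t)-paths Q₁, Q₂ of C have interiors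
--   Q₁* = { c j | j strictly between a and b }   and
--   Q₂* = { c j | j ≠ a, j ≠ b, j not strictly between a and b }.

Between : ∀ {k} → Fin k → Fin k → Fin k → Set
Between a b j = ((toℕ a < toℕ j) × (toℕ j < toℕ b)) ⊎ ((toℕ b < toℕ j) × (toℕ j < toℕ a))

InQ₁* : ∀ {k} → Fin k → Fin k → Fin k → Set
InQ₁* a b j = Between a b j

InQ₂* : ∀ {k} → Fin k → Fin k → Fin k → Set
InQ₂* a b j = (j ≢ a) × (j ≢ b) × ¬ Between a b j

record IsJump {n k} (G : Graph n) (c : Fin k → Fin n) (a b : Fin k)
              (m : ℕ) (p : Fin (suc m) → Fin n) : Set where
  field
    ends-distinct : c a ≢ c b
    ends-nonadj   : ¬ Adj G (c a) (c b)
    path          : IsInducedPath G m p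
    start         : p fz ≡ c a
    end           : p (fromℕ m) ≡ c b
    disjoint      : ∀ i → Internal m i → ∀ j → p i ≢ c j

Touches : ∀ {n k} (G : Graph n) (c : Fin k → Fin n) (Q : Fin k → Set)
          (m : ℕ) (p : Fin (suc m) → Fin n) → Set
Touches G c Q m p = ∃[ j ] Q j × ∃[ i ] Internal m i × Adj G (c j) (p i)

IsLocal : ∀ {n k} (G : Graph n) (c : Fin k → Fin n) (a b : Fin k)
          (m : ℕ) (p : Fin (suc m) → Fin n) → Set
IsLocal G c a b m p =
  (Touches G c (InQ₁* a b) m p × ¬ Touches G c (InQ₂* a b) m p) ⊎
  (Touches G c (InQ₂* a b) m p × ¬ Touches G c (InQ₁* a b) m p)

IsShortJump : ∀ {n k} (G : Graph n) (c : Fin k → Fin n) (a b : Fin k)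
              (m : ℕ) (p : Fin (suc m) → Fin n) → Set
IsShortJump G c a b m p =
  IsJump G c a b m p ×
  ¬ Touches G c (InQ₁* a b) m p × ¬ Touches G c (InQ₂* a b) m p

InCP : ∀ {n k m} → (Fin k → Fin n) → (Fin (suc m) → Fin n) → Fin n → Set
InCP {m = m} c p v = (∃[ j ] v ≡ c j) ⊎ (∃[ i ] v ≡ p i)

-- Since C is an odd hole and no odd hole is longer than 2ℓ + 1, C has exactly the length of the
-- girth. A vertex off C with two neighbours on C would close a cycle through each of the two arcs
-- of C between them, and one of those is shorter than C; so every internal vertex of P has at
-- most one neighbour on C. If P is not local, internal vertices of P see both Q₁* and Q₂*. Between
-- an attachment to one side and the next attachment to the other, the subpath of P has no
-- neighbours on C, and together with the two attachment vertices it is a short jump.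
module Submission where

open import Defs
open import Data.Nat using (ℕ; zero; suc; _+_; _*_; _∸_; _≤_; _<_; z≤n; s≤s; _≤?_; _<?_; NonZero)
open import Data.Nat.Properties renaming (_≟_ to _≟ℕ_)
open import Data.Nat.DivMod
  using (_mod_; _%_; m%n<n; m<n⇒m%n≡m; n%n≡0; m%n%n≡m%n; [m+n]%n≡m%n; %-distribˡ-+; m≤n⇒[n∸m]%m≡n%m)
open import Data.Fin using (Fin; zero; suc; toℕ; fromℕ)
open import Data.Fin.Properties using (toℕ-injective; toℕ<n; toℕ≤pred[n]; toℕ-fromℕ<; toℕ-fromℕ; _≟_; any?)
open import Data.Sum using (_⊎_; inj₁; inj₂)
open import Data.Product using (_×_; _,_; Σ; ∃; ∃-syntax; proj₁; proj₂)
open import Data.Bool using (T)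
open import Data.Empty using (⊥; ⊥-elim)
open import Function.Base using (_∘_)
open import Function.Definitions using (Injective)
open import Relation.Binary.Definitions using (Tri; tri<; tri≈; tri>)
open import Relation.Binary.PropositionalEquality
open import Relation.Nullary using (¬_; Dec; yes; no; contradiction)
open import Relation.Nullary.Decidable using (¬?; _×-dec_; _⊎-dec_; T?)

[m+n]%d≡[m%d+n]%d : ∀ m n d .{{_ : NonZero d}} → (m + n) % d ≡ (m % d + n) % d
[m+n]%d≡[m%d+n]%d m n d = begin
  (m + n) % d              ≡⟨ %-distribˡ-+ m n d ⟩
  (m % d + n % d) % d      ≡⟨ cong (λ x → (x + n % d) % d) (m%n%n≡m%n m d) ⟨
  (m % d % d + n % d) % d  ≡⟨ %-distribˡ-+ (m % d) n d ⟨
  (m % d + n) % d          ∎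
  where open ≡-Reasoning

[1+m]%n≡[1+m%n]%n : ∀ m n .{{_ : NonZero n}} → suc m % n ≡ suc (m % n) % n
[1+m]%n≡[1+m%n]%n m n = begin
  suc m % n          ≡⟨ cong (_% n) (+-comm 1 m) ⟩
  (m + 1) % n        ≡⟨ [m+n]%d≡[m%d+n]%d m 1 n ⟩
  (m % n + 1) % n    ≡⟨ cong (_% n) (+-comm (m % n) 1) ⟩
  suc (m % n) % n    ∎
  where open ≡-Reasoning

[1+m]%n-step-or-wrap : ∀ m n .{{_ : NonZero n}} →
  (suc (m % n) ≡ suc m % n) ⊎ ((suc (m % n) ≡ n) × (suc m % n ≡ 0))
[1+m]%n-step-or-wrap m n with suc (m % n) <? n
... | yes 1+r<n = inj₁ (sym (trans ([1+m]%n≡[1+m%n]%n m n) (m<n⇒m%n≡m 1+r<n)))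
... | no 1+r≮n = inj₂ (1+r≡n , trans ([1+m]%n≡[1+m%n]%n m n) (trans (cong (_% n) 1+r≡n) (n%n≡0 n)))
  where
  1+r≡n : suc (m % n) ≡ n
  1+r≡n = ≤-antisym (m%n<n m n) (≮⇒≥ 1+r≮n)

m%n≢[m+d]%n : ∀ m d n .{{_ : NonZero n}} → 0 < d → d < n → m % n ≢ (m + d) % n
m%n≢[m+d]%n m (suc d) n _ d<n eq with m % n + suc d <? n
... | yes r+d<n = m+1+n≢m (m % n) (sym (trans (trans eq ([m+n]%d≡[m%d+n]%d m (suc d) n)) (m<n⇒m%n≡m r+d<n)))
... | no r+d≮n = <-irrefl (sym r≡r+d∸n) r+d∸n<r
  where
  r = m % n
  n≤r+d : n ≤ r + suc d
  n≤r+d = ≮⇒≥ r+d≮n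
  r+d∸n<r : r + suc d ∸ n < r
  r+d∸n<r = subst (r + suc d ∸ n <_) (m+n∸n≡m r n) (∸-monoˡ-< (+-monoʳ-< r d<n) n≤r+d)
  r≡r+d∸n : r ≡ r + suc d ∸ n
  r≡r+d∸n = begin
    r                     ≡⟨ trans eq ([m+n]%d≡[m%d+n]%d m (suc d) n) ⟩
    (r + suc d) % n       ≡⟨ m≤n⇒[n∸m]%m≡n%m n≤r+d ⟨
    (r + suc d ∸ n) % n   ≡⟨ m<n⇒m%n≡m (<-trans r+d∸n<r (m%n<n m n)) ⟩
    r + suc d ∸ n         ∎
    where open ≡-Reasoning

module _ {k : ℕ} .{{_ : NonZero k}} where

  toℕ-mod : ∀ s → toℕ (s mod k) ≡ s % k
  toℕ-mod s = toℕ-fromℕ< (m%n<n s k)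

  toℕ-mod< : ∀ {s} → s < k → toℕ (s mod k) ≡ s
  toℕ-mod< {s} s<k = trans (toℕ-mod s) (m<n⇒m%n≡m s<k)

  mod-toℕ : ∀ (i : Fin k) → toℕ i mod k ≡ i
  mod-toℕ i = toℕ-injective (toℕ-mod< (toℕ<n i))

  mod-periodic : ∀ s → (s + k) mod k ≡ s mod k
  mod-periodic s = toℕ-injective (trans (toℕ-mod (s + k)) (trans ([m+n]%n≡m%n s k) (sym (toℕ-mod s))))

  mod-suc-CSucc : ∀ s → CSucc k (s mod k) (suc s mod k)
  mod-suc-CSucc s rewrite toℕ-mod s | toℕ-mod (suc s) = [1+m]%n-step-or-wrap s k

  mod-injective-on-window : ∀ s {d} → 0 < d → d < k → s mod k ≢ (s + d) mod k
  mod-injective-on-window s {d} 0<d d<k eq =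
    m%n≢[m+d]%n s d k 0<d d<k (trans (sym (toℕ-mod s)) (trans (cong toℕ eq) (toℕ-mod (s + d))))

  -- Reads a cycle around and around; on a path p : Fin (suc m) → _ only indices t ≤ m are
  -- meaningful, and reducing mod suc m merely saves carrying bound proofs.
  walk : ∀ {A : Set} → (Fin k → A) → ℕ → A
  walk f t = f (t mod k)

  walk-toℕ : ∀ {A : Set} (f : Fin k → A) i → walk f (toℕ i) ≡ f i
  walk-toℕ f i = cong f (mod-toℕ i)

  walk-periodic : ∀ {A : Set} (f : Fin k → A) s → walk f (s + k) ≡ walk f s
  walk-periodic f s = cong f (mod-periodic s)

∘toℕ-injective : ∀ {A : Set} m (f : ℕ → A) → (∀ {s t} → s < t → t ≤ m → f s ≢ f t) →
  Injective _≡_ _≡_ (λ (i : Fin (suc m)) → f (toℕ i))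
∘toℕ-injective m f distinct {i} {j} eq with <-cmp (toℕ i) (toℕ j)
... | tri< i<j _ _ = contradiction eq (distinct i<j (toℕ≤pred[n] j))
... | tri≈ _ i≡j _ = toℕ-injective i≡j
... | tri> _ _ j<i = contradiction (sym eq) (distinct j<i (toℕ≤pred[n] i))

module _ {n : ℕ} (G : Graph n) where

  adj-sym : ∀ {u v} → Adj G u v → Adj G v u
  adj-sym {u} {v} = subst T (Graph.sym G u v)

  stepAdj : ∀ {L} (f : ℕ → Fin n) → (∀ {t} → t < L → Adj G (f t) (f (suc t))) →
    ∀ {s t} → suc s ≡ t → t ≤ L → Adj G (f s) (f t)
  stepAdj f step refl = step

  pathFromℕ : ∀ m (f : ℕ → Fin n) →
    (∀ {s t} → s < t → t ≤ m → f s ≢ f t) →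
    (∀ {t} → t < m → Adj G (f t) (f (suc t))) →
    (∀ {s t} → s < t → t ≤ m → Adj G (f s) (f t) → suc s ≡ t) →
    IsInducedPath G m (λ i → f (toℕ i))
  pathFromℕ m f distinct step induced = record
    { inj = ∘toℕ-injective m f distinct
    ; edges = edges
    ; induced = λ i j → consec (<-cmp (toℕ i) (toℕ j)) }
    where
    edges : ∀ i j → Consec i j → Adj G (f (toℕ i)) (f (toℕ j))
    edges i j (inj₁ eq) = stepAdj f step eq (toℕ≤pred[n] j)
    edges i j (inj₂ eq) = adj-sym (stepAdj f step eq (toℕ≤pred[n] i))

    consec : ∀ {i j} → Tri (toℕ i < toℕ j) (toℕ i ≡ toℕ j) (toℕ j < toℕ i) →
             Adj G (f (toℕ i)) (f (toℕ j)) → Consec i j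
    consec {i} {j} (tri< i<j _ _) a = inj₁ (induced i<j (toℕ≤pred[n] j) a)
    consec {i} {j} (tri≈ _ i≡j _) a = contradiction (subst (λ t → Adj G (f t) (f (toℕ j))) i≡j a) (Graph.irrefl G _)
    consec {i} {j} (tri> _ _ j<i) a = inj₂ (induced j<i (toℕ≤pred[n] i) (adj-sym a))

  cycleFromℕ : ∀ L (f : ℕ → Fin n) → 2 ≤ L →
    (∀ {s t} → s < t → t ≤ L → f s ≢ f t) →
    (∀ {t} → t < L → Adj G (f t) (f (suc t))) →
    Adj G (f L) (f 0) →
    IsCycle G (suc L) (λ i → f (toℕ i))
  cycleFromℕ L f 2≤L distinct step closing = record
    { length≥3 = s≤s 2≤L
    ; inj = ∘toℕ-injective L f distinct
    ; edges = edges }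
    where
    edges : ∀ i j → CSucc (suc L) i j → Adj G (f (toℕ i)) (f (toℕ j))
    edges i j (inj₁ eq) = stepAdj f step eq (toℕ≤pred[n] j)
    edges i j (inj₂ (i≡L , j≡0)) rewrite suc-injective i≡L | j≡0 = closing

hole⇒cycle : ∀ {n} {G : Graph n} {k c} → IsHole G k c → IsCycle G k c
hole⇒cycle H = record
  { length≥3 = ≤-trans (n≤1+n 3) (IsHole.length≥4 H)
  ; inj = IsHole.inj H
  ; edges = λ i j i→j → IsHole.edges H i j (inj₁ i→j) }

module CycleWalk {n} (G : Graph n) {k} .{{_ : NonZero k}} {c : Fin k → Fin n} (C : IsCycle G k c) where

  walk-edge : ∀ s → Adj G (walk c s) (walk c (suc s))
  walk-edge s = IsCycle.edges C _ _ (mod-suc-CSucc s)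

  walk-injective : ∀ s {d} → 0 < d → d < k → walk c s ≢ walk c (s + d)
  walk-injective s 0<d d<k = mod-injective-on-window s 0<d d<k ∘ IsCycle.inj C

  arcCycle : ∀ x → (∀ j → x ≢ c j) → ∀ S D → 1 ≤ D → D < k →
    Adj G (walk c S) x → Adj G (walk c (S + D)) x →
    Σ (Fin (2 + D) → Fin n) (IsCycle G (2 + D))
  arcCycle x off S D 1≤D D<k xS xSD = _ , cycleFromℕ G (suc D) vertex (s≤s 1≤D) distinct step xSD
    where
    vertex : ℕ → Fin n
    vertex zero = x
    vertex (suc t) = walk c (S + t)

    distinct : ∀ {s t} → s < t → t ≤ suc D → vertex s ≢ vertex t
    distinct {zero} {suc t} _ _ = off _
    distinct {suc s} {suc t} (s≤s s<t) (s≤s t≤D) eq =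
      walk-injective (S + s) (m<n⇒0<n∸m s<t) (≤-<-trans (≤-trans (m∸n≤m t s) t≤D) D<k)
        (trans eq (cong (walk c) S+t≡S+s+[t∸s]))
      where
      S+t≡S+s+[t∸s] : S + t ≡ S + s + (t ∸ s)
      S+t≡S+s+[t∸s] = trans (cong (S +_) (sym (m+[n∸m]≡n (<⇒≤ s<t)))) (sym (+-assoc S s (t ∸ s)))

    step : ∀ {t} → t < suc D → Adj G (vertex t) (vertex (suc t))
    step {zero} _ = adj-sym G (subst (λ r → Adj G (walk c r) x) (sym (+-identityʳ S)) xS)
    step {suc t} _ = subst (Adj G (walk c (S + t)) ∘ walk c) (sym (+-suc S t)) (walk-edge (S + t))

  module _ (5≤k : 5 ≤ k) (shortest : ∀ L → L < k → (f : Fin L → Fin n) → ¬ IsCycle G L f) where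

    no-arc-neighbours : ∀ x → (∀ j → x ≢ c j) → ∀ U D → 1 ≤ D → D < k →
      Adj G (walk c U) x → Adj G (walk c (U + D)) x → ⊥
    -- The two arcs of C between the neighbours close cycles of lengths D + 2 and k ∸ D + 2 through x.
    no-arc-neighbours x off U D 1≤D D<k xU xUD with D ≤? 2
    ... | yes D≤2 = shortest (2 + D) (≤-<-trans (+-monoʳ-≤ 2 D≤2) 5≤k) _
                      (proj₂ (arcCycle x off U D 1≤D D<k xU xUD))
    ... | no D≰2 = shortest (2 + (k ∸ D)) around _
                     (proj₂ (arcCycle x off (U + D) (k ∸ D) (m<n⇒0<n∸m D<k) (∸-monoʳ-< 1≤D (<⇒≤ D<k)) xUD xU+k))
      where
      around : 2 + (k ∸ D) < k
      around = subst (3 + (k ∸ D) ≤_) (m+[n∸m]≡n (<⇒≤ D<k)) (+-monoˡ-≤ (k ∸ D) (≰⇒> D≰2))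
      U+D+[k∸D]≡U+k : U + D + (k ∸ D) ≡ U + k
      U+D+[k∸D]≡U+k = trans (+-assoc U D (k ∸ D)) (cong (U +_) (m+[n∸m]≡n (<⇒≤ D<k)))
      xU+k : Adj G (walk c (U + D + (k ∸ D))) x
      xU+k = subst (λ y → Adj G y x) (sym (trans (cong (walk c) U+D+[k∸D]≡U+k) (walk-periodic c U))) xU

    no-ordered-neighbours : ∀ x → (∀ j → x ≢ c j) → ∀ u w → toℕ u < toℕ w →
      Adj G (c u) x → Adj G (c w) x → ⊥
    no-ordered-neighbours x off u w u<w xu xw =
      no-arc-neighbours x off (toℕ u) (toℕ w ∸ toℕ u) (m<n⇒0<n∸m u<w)
        (≤-<-trans (m∸n≤m (toℕ w) (toℕ u)) (toℕ<n w))
        (subst (λ y → Adj G y x) (sym (walk-toℕ c u)) xu)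
        (subst (λ y → Adj G y x) (sym (trans (cong (walk c) (m+[n∸m]≡n (<⇒≤ u<w))) (walk-toℕ c w))) xw)

    unique-neighbour : ∀ x → (∀ j → x ≢ c j) → ∀ u w → Adj G (c u) x → Adj G (c w) x → u ≡ w
    unique-neighbour x off u w xu xw with <-cmp (toℕ u) (toℕ w)
    ... | tri< u<w _ _ = ⊥-elim (no-ordered-neighbours x off u w u<w xu xw)
    ... | tri≈ _ u≡w _ = toℕ-injective u≡w
    ... | tri> _ _ w<u = ⊥-elim (no-ordered-neighbours x off w u w<u xw xu)

module InducedPathWalk {n} {G : Graph n} {m} {p : Fin (suc m) → Fin n} (P : IsInducedPath G m p) where

  toℕ-index : ∀ {t} → t ≤ m → toℕ (t mod suc m) ≡ t
  toℕ-index t≤m = toℕ-mod< (s≤s t≤m)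

  walk-injective : ∀ {s t} → s < t → t ≤ m → walk p s ≢ walk p t
  walk-injective {s} {t} s<t t≤m eq = <⇒≢ s<t (begin
    s                    ≡⟨ toℕ-index (<⇒≤ (<-≤-trans s<t t≤m)) ⟨
    toℕ (s mod suc m)    ≡⟨ cong toℕ (IsInducedPath.inj P eq) ⟩
    toℕ (t mod suc m)    ≡⟨ toℕ-index t≤m ⟩
    t                    ∎)
    where open ≡-Reasoning

  walk-edge : ∀ {t} → t < m → Adj G (walk p t) (walk p (suc t))
  walk-edge {t} t<m = IsInducedPath.edges P _ _ (inj₁ (trans (cong suc (toℕ-index (<⇒≤ t<m))) (sym (toℕ-index t<m))))

  walk-induced : ∀ {s t} → s < t → t ≤ m → Adj G (walk p s) (walk p t) → suc s ≡ t
  walk-induced {s} {t} s<t t≤m a = consecutive (IsInducedPath.induced P _ _ a)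
    where
    s≤m : s ≤ m
    s≤m = <⇒≤ (<-≤-trans s<t t≤m)
    consecutive : Consec (s mod suc m) (t mod suc m) → suc s ≡ t
    consecutive (inj₁ 1+s≡t) = subst₂ (λ x y → suc x ≡ y) (toℕ-index s≤m) (toℕ-index t≤m) 1+s≡t
    consecutive (inj₂ 1+t≡s) =
      contradiction (subst₂ (λ x y → suc x ≡ y) (toℕ-index t≤m) (toℕ-index s≤m) 1+t≡s) (<⇒≢ (m<n⇒m<1+n s<t) ∘ sym)

¬Between-left : ∀ {k} (a b : Fin k) → ¬ Between a b a
¬Between-left a b (inj₁ (a<a , _)) = <-irrefl refl a<a
¬Between-left a b (inj₂ (_ , a<a)) = <-irrefl refl a<a

¬Between-right : ∀ {k} (a b : Fin k) → ¬ Between a b b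
¬Between-right a b (inj₁ (_ , b<b)) = <-irrefl refl b<b
¬Between-right a b (inj₂ (b<b , _)) = <-irrefl refl b<b

ShortJumpIn : ∀ {n k m} → Graph n → (Fin k → Fin n) → (Fin (suc m) → Fin n) → Set
ShortJumpIn {n} G c p = ∃[ a ] ∃[ b ] ∃[ m' ] Σ (Fin (suc m') → Fin n) λ p' →
  IsShortJump G c a b m' p' × (∀ i → InCP c p (p' i))

module Detour {n} (G : Graph n) {k} (c : Fin k → Fin n)
  {m} {p : Fin (suc m) → Fin n} (P : IsInducedPath G m p)
  (i D : ℕ) (i+D≤m : i + D ≤ m) (u v : Fin k)
  (cu≢cv : c u ≢ c v) (cu≁cv : ¬ Adj G (c u) (c v))
  (u~first : Adj G (c u) (walk p i)) (v~last : Adj G (c v) (walk p (i + D)))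
  (off : ∀ {r} → r ≤ D → ∀ j → walk p (i + r) ≢ c j)
  (attached : ∀ {r} → r ≤ D → ∀ w → Adj G (c w) (walk p (i + r)) → (r ≡ 0 × w ≡ u) ⊎ (r ≡ D × w ≡ v))
  where

  open InducedPathWalk P

  vertex : ℕ → Fin n
  vertex zero = c u
  vertex (suc r) with r ≤? D
  ... | yes _ = walk p (i + r)
  ... | no _ = c v

  vertex-middle : ∀ {r} → r ≤ D → vertex (suc r) ≡ walk p (i + r)
  vertex-middle {r} r≤D with r ≤? D
  ... | yes _ = refl
  ... | no r≰D = contradiction r≤D r≰D

  vertex-end : vertex (2 + D) ≡ c v
  vertex-end with suc D ≤? D
  ... | yes D+1≤D = contradiction D+1≤D (1+n≰n)
  ... | no _ = refl

  data Position : ℕ → Set where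
    start  : Position 0
    middle : ∀ {r} → r ≤ D → Position (suc r)
    end    : Position (2 + D)

  position : ∀ {t} → t ≤ 2 + D → Position t
  position {zero} _ = start
  position {suc r} t≤ with r ≤? D
  ... | yes r≤D = middle r≤D
  ... | no r≰D = subst (λ r → Position (suc r)) (sym (≤-antisym (≤-pred t≤) (≰⇒> r≰D))) end

  position-≤ : ∀ {t} → Position t → t ≤ 2 + D
  position-≤ start = z≤n
  position-≤ (middle r≤D) = s≤s (m≤n⇒m≤1+n r≤D)
  position-≤ end = ≤-refl

  i+r≤m : ∀ {r} → r ≤ D → i + r ≤ m
  i+r≤m r≤D = ≤-trans (+-monoʳ-≤ i r≤D) i+D≤m

  u≢v : u ≢ v
  u≢v u≡v = cu≢cv (cong c u≡v)

  distinct : ∀ {s t} → s < t → t ≤ 2 + D → vertex s ≢ vertex t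
  distinct {s} {t} s<t t≤ = go (position (<⇒≤ (<-≤-trans s<t t≤))) (position t≤) s<t
    where
    go : ∀ {s t} → Position s → Position t → s < t → vertex s ≢ vertex t
    go start (middle r≤D) _ eq = off r≤D u (sym (trans eq (vertex-middle r≤D)))
    go start end _ eq = cu≢cv (trans eq vertex-end)
    go (middle r≤D) (middle r'≤D) (s≤s r<r') eq =
      walk-injective (+-monoʳ-< i r<r') (i+r≤m r'≤D) (trans (sym (vertex-middle r≤D)) (trans eq (vertex-middle r'≤D)))
    go (middle r≤D) end _ eq = off r≤D v (trans (sym (vertex-middle r≤D)) (trans eq vertex-end))
    go (middle r≤D) start ()
    go start start ()
    go end q 2+D<t _ = contradiction (position-≤ q) (<⇒≱ 2+D<t)

  induced : ∀ {s t} → s < t → t ≤ 2 + D → Adj G (vertex s) (vertex t) → suc s ≡ t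
  induced {s} {t} s<t t≤ = go (position (<⇒≤ (<-≤-trans s<t t≤))) (position t≤) s<t
    where
    go : ∀ {s t} → Position s → Position t → s < t → Adj G (vertex s) (vertex t) → suc s ≡ t
    go start (middle r≤D) _ a with attached r≤D u (subst (Adj G (c u)) (vertex-middle r≤D) a)
    ... | inj₁ (refl , _) = refl
    ... | inj₂ (_ , u≡v) = contradiction u≡v u≢v
    go start end _ a = contradiction (subst (Adj G (c u)) vertex-end a) cu≁cv
    go (middle r≤D) (middle r'≤D) (s≤s r<r') a =
      cong suc (+-cancelˡ-≡ i _ _ (trans (+-suc i _)
        (walk-induced (+-monoʳ-< i r<r') (i+r≤m r'≤D) (subst₂ (Adj G) (vertex-middle r≤D) (vertex-middle r'≤D) a))))
    go (middle r≤D) end _ a with attached r≤D v (adj-sym G (subst₂ (Adj G) (vertex-middle r≤D) vertex-end a))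
    ... | inj₁ (_ , v≡u) = contradiction (sym v≡u) u≢v
    ... | inj₂ (refl , _) = refl
    go start start ()
    go (middle r≤D) start ()
    go end q 2+D<t _ = contradiction (position-≤ q) (<⇒≱ 2+D<t)

  step : ∀ {t} → t < 2 + D → Adj G (vertex t) (vertex (suc t))
  step {zero} _ = subst (Adj G (c u)) (sym (trans (vertex-middle z≤n) (cong (walk p) (+-identityʳ i)))) u~first
  step {suc r} (s≤s (s≤s r≤D)) with m≤n⇒m<n∨m≡n r≤D
  ... | inj₁ r<D =
    subst₂ (Adj G) (sym (vertex-middle (<⇒≤ r<D))) (sym (trans (vertex-middle r<D) (cong (walk p) (+-suc i r))))
      (walk-edge (<-≤-trans (+-monoʳ-< i r<D) i+D≤m))
  ... | inj₂ refl = subst₂ (Adj G) (sym (vertex-middle ≤-refl)) (sym vertex-end) (adj-sym G v~last)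

  detour : Fin (3 + D) → Fin n
  detour t = vertex (toℕ t)

  internal-middle : ∀ t → Internal (2 + D) t → ∃[ r ] r ≤ D × detour t ≡ walk p (i + r)
  internal-middle t (t≢0 , t≢end) = go (position (toℕ≤pred[n] t)) t≢0 t≢end
    where
    go : ∀ {s} → Position s → s ≢ 0 → s ≢ 2 + D → ∃[ r ] r ≤ D × vertex s ≡ walk p (i + r)
    go start s≢0 _ = contradiction refl s≢0
    go (middle {r} r≤D) _ _ = r , r≤D , vertex-middle r≤D
    go end _ s≢end = contradiction refl s≢end

  in-C∪P : ∀ t → InCP c p (detour t)
  in-C∪P t = go (position (toℕ≤pred[n] t))
    where
    go : ∀ {s} → Position s → InCP c p (vertex s)
    go start = inj₁ (u , refl)
    go (middle {r} r≤D) = inj₂ (_ , vertex-middle r≤D)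
    go end = inj₁ (v , vertex-end)

  internal-neighbour : ∀ t → Internal (2 + D) t → ∀ w → Adj G (c w) (detour t) → w ≡ u ⊎ w ≡ v
  internal-neighbour t int w a with internal-middle t int
  ... | r , r≤D , eq with attached r≤D w (subst (Adj G (c w)) eq a)
  ...   | inj₁ (_ , w≡u) = inj₁ w≡u
  ...   | inj₂ (_ , w≡v) = inj₂ w≡v

  isJump : IsJump G c u v (2 + D) detour
  isJump = record
    { ends-distinct = cu≢cv
    ; ends-nonadj = cu≁cv
    ; path = pathFromℕ G (2 + D) vertex distinct step induced
    ; start = refl
    ; end = trans (cong vertex (toℕ-fromℕ (2 + D))) vertex-end
    ; disjoint = λ t int j → let (r , r≤D , eq) = internal-middle t int in off r≤D j ∘ trans (sym eq) }

  isShortJump : IsShortJump G c u v (2 + D) detour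
  isShortJump = isJump , noTouch₁ , noTouch₂
    where
    noTouch₁ : ¬ Touches G c (InQ₁* u v) (2 + D) detour
    noTouch₁ (w , w∈Q₁ , t , int , a) with internal-neighbour t int w a
    ... | inj₁ refl = ¬Between-left u v w∈Q₁
    ... | inj₂ refl = ¬Between-right u v w∈Q₁
    noTouch₂ : ¬ Touches G c (InQ₂* u v) (2 + D) detour
    noTouch₂ (w , (w≢u , w≢v , _) , t , int , a) with internal-neighbour t int w a
    ... | inj₁ w≡u = w≢u w≡u
    ... | inj₂ w≡v = w≢v w≡v

  shortJumpIn : ShortJumpIn G c p
  shortJumpIn = u , v , 2 + D , detour , isShortJump , in-C∪P

module _ {A B : ℕ → Set} where

  Clear : ℕ → ℕ → Set
  Clear i j = ∀ {r} → i < r → r < j → ¬ A r × ¬ B r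

  Switch : Set
  Switch = ∃[ i ] ∃[ j ] i < j × A i × B j × Clear i j

  clear-adjacent : ∀ {i} → Clear i (suc i)
  clear-adjacent i<r r<1+i = contradiction (≤-pred r<1+i) (<⇒≱ i<r)

  switch : (∀ t → Dec (A t)) → (∀ t → Dec (B t)) → ∀ {i j} → i < j → A i → B j → Switch
  switch A? B? {i} {j} i<j Ai Bj =
    search (j ∸ suc i) (n<1+n i) Ai clear-adjacent (subst B (sym (m+[n∸m]≡n i<j)) Bj)
    where
    search : ∀ d {i j} → i < j → A i → Clear i j → B (j + d) → Switch
    search d {i} {j} i<j Ai clear Bj+d with B? j
    ... | yes Bj = i , j , i<j , Ai , Bj , clear
    search zero {j = j} _ _ _ Bj+d | no ¬Bj = contradiction (subst B (+-identityʳ j) Bj+d) ¬Bj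
    search (suc d) {i} {j} i<j Ai clear Bj+d | no ¬Bj with A? j
    ... | yes Aj = search d (n<1+n j) Aj clear-adjacent (subst B (+-suc j d) Bj+d)
    ... | no ¬Aj = search d (m<n⇒m<1+n i<j) Ai clear′ (subst B (+-suc j d) Bj+d)
      where
      clear′ : Clear i (suc j)
      clear′ i<r r≤j with m≤n⇒m<n∨m≡n (≤-pred r≤j)
      ... | inj₁ r<j = clear i<r r<j
      ... | inj₂ refl = ¬Aj , ¬Bj

module _ {k} (a b : Fin k) where

  Between? : ∀ j → Dec (Between a b j)
  Between? j = ((toℕ a <? toℕ j) ×-dec (toℕ j <? toℕ b)) ⊎-dec ((toℕ b <? toℕ j) ×-dec (toℕ j <? toℕ a))

  InQ₂*? : ∀ j → Dec (InQ₂* a b j)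
  InQ₂*? j = ¬? (j ≟ a) ×-dec ¬? (j ≟ b) ×-dec ¬? (Between? j)

  private
    toℕ-≢ : ∀ {x y : Fin k} → x ≢ y → toℕ x ≢ toℕ y
    toℕ-≢ x≢y = x≢y ∘ toℕ-injective

  Between-suc : ∀ {u v} → Between a b u → suc (toℕ u) ≡ toℕ v → v ≢ a → v ≢ b → Between a b v
  Between-suc (inj₁ (a<u , u<b)) 1+u≡v _ v≢b =
    inj₁ (subst (toℕ a <_) 1+u≡v (m<n⇒m<1+n a<u) , ≤∧≢⇒< (subst (_≤ toℕ b) 1+u≡v u<b) (toℕ-≢ v≢b))
  Between-suc (inj₂ (b<u , u<a)) 1+u≡v v≢a _ =
    inj₂ (subst (toℕ b <_) 1+u≡v (m<n⇒m<1+n b<u) , ≤∧≢⇒< (subst (_≤ toℕ a) 1+u≡v u<a) (toℕ-≢ v≢a))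

  Between-pred : ∀ {u v} → Between a b u → suc (toℕ v) ≡ toℕ u → v ≢ a → v ≢ b → Between a b v
  Between-pred (inj₁ (a<u , u<b)) 1+v≡u v≢a _ =
    inj₁ (≤∧≢⇒< (≤-pred (subst (toℕ a <_) (sym 1+v≡u) a<u)) (toℕ-≢ v≢a ∘ sym) ,
          <-trans (≤-reflexive 1+v≡u) u<b)
  Between-pred (inj₂ (b<u , u<a)) 1+v≡u _ v≢b =
    inj₂ (≤∧≢⇒< (≤-pred (subst (toℕ b <_) (sym 1+v≡u) b<u)) (toℕ-≢ v≢b ∘ sym) ,
          <-trans (≤-reflexive 1+v≡u) u<a)

  Between-not-last : ∀ {u} → Between a b u → suc (toℕ u) ≢ k
  Between-not-last (inj₁ (_ , u<b)) 1+u≡k = <⇒≱ (toℕ<n b) (subst (_≤ toℕ b) 1+u≡k u<b)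
  Between-not-last (inj₂ (_ , u<a)) 1+u≡k = <⇒≱ (toℕ<n a) (subst (_≤ toℕ a) 1+u≡k u<a)

  Between-not-zero : ∀ {u} → Between a b u → toℕ u ≢ 0
  Between-not-zero (inj₁ (a<u , _)) u≡0 = n≮0 (subst (toℕ a <_) u≡0 a<u)
  Between-not-zero (inj₂ (b<u , _)) u≡0 = n≮0 (subst (toℕ b <_) u≡0 b<u)

  Q₁*-Q₂*-not-cyclically-adjacent : ∀ {u v} → InQ₁* a b u → InQ₂* a b v → ¬ CycAdj k u v
  Q₁*-Q₂*-not-cyclically-adjacent u∈Q₁ (v≢a , v≢b , v∉Q₁) (inj₁ (inj₁ u→v)) =
    v∉Q₁ (Between-suc u∈Q₁ u→v v≢a v≢b)
  Q₁*-Q₂*-not-cyclically-adjacent u∈Q₁ _ (inj₁ (inj₂ (u-last , _))) = Between-not-last u∈Q₁ u-last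
  Q₁*-Q₂*-not-cyclically-adjacent u∈Q₁ (v≢a , v≢b , v∉Q₁) (inj₂ (inj₁ v→u)) =
    v∉Q₁ (Between-pred u∈Q₁ v→u v≢a v≢b)
  Q₁*-Q₂*-not-cyclically-adjacent u∈Q₁ _ (inj₂ (inj₂ (_ , u≡0))) = Between-not-zero u∈Q₁ u≡0

module NonLocalJump {n} (G : Graph n) {k} {c : Fin k → Fin n} (H : IsHole G k c)
  (unique-neighbour : ∀ x → (∀ j → x ≢ c j) → ∀ u w → Adj G (c u) x → Adj G (c w) x → u ≡ w)
  {a b m} {p : Fin (suc m) → Fin n} (J : IsJump G c a b m p) where

  open InducedPathWalk (IsJump.path J)

  Attaches : (Fin k → Set) → ℕ → Set
  Attaches Q t = 0 < t × t < m × ∃[ w ] Q w × Adj G (c w) (walk p t)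

  Attaches? : ∀ {Q} → (∀ j → Dec (Q j)) → ∀ t → Dec (Attaches Q t)
  Attaches? Q? t = (0 <? t) ×-dec (t <? m) ×-dec any? (λ w → Q? w ×-dec T? (Graph.adj G (c w) (walk p t)))

  Touches? : ∀ {Q} → (∀ j → Dec (Q j)) → Dec (Touches G c Q m p)
  Touches? Q? = any? λ w → Q? w ×-dec any? λ i →
    (¬? (toℕ i ≟ℕ 0) ×-dec ¬? (toℕ i ≟ℕ m)) ×-dec T? (Graph.adj G (c w) (p i))

  touches⇒attaches : ∀ {Q} → Touches G c Q m p → ∃[ t ] Attaches Q t
  touches⇒attaches (w , w∈Q , i , (i≢0 , i≢m) , w~i) =
    toℕ i , n≢0⇒n>0 i≢0 , ≤∧≢⇒< (toℕ≤pred[n] i) i≢m , w , w∈Q , subst (Adj G (c w)) (sym (walk-toℕ p i)) w~i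

  walk-internal-off-C : ∀ {t} → 0 < t → t < m → ∀ j → walk p t ≢ c j
  walk-internal-off-C {t} 0<t t<m = IsJump.disjoint J (t mod suc m) (t≢0 , t≢m)
    where
    t≢0 : toℕ (t mod suc m) ≢ 0
    t≢0 eq = <⇒≢ 0<t (sym (trans (sym (toℕ-mod< (m<n⇒m<1+n t<m))) eq))
    t≢m : toℕ (t mod suc m) ≢ m
    t≢m eq = <⇒≢ t<m (trans (sym (toℕ-mod< (m<n⇒m<1+n t<m))) eq)

  unique-attachment : ∀ {t} → 0 < t → t < m → ∀ u w → Adj G (c u) (walk p t) → Adj G (c w) (walk p t) → u ≡ w
  unique-attachment 0<t t<m = unique-neighbour _ (walk-internal-off-C 0<t t<m)

  walk-start : walk p 0 ≡ c a
  walk-start = trans (walk-toℕ p zero) (IsJump.start J)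

  walk-end : walk p m ≡ c b
  walk-end = trans (sym (cong (walk p) (toℕ-fromℕ m))) (trans (walk-toℕ p (fromℕ m)) (IsJump.end J))

  Q₁* Q₂* : Fin k → Set
  Q₁* = InQ₁* a b
  Q₂* = InQ₂* a b

  -- An internal vertex at distance at least 2 from both ends of the induced path P cannot see
  -- its ends c a and c b, so all its neighbours on C lie in Q₁* or Q₂*.
  attachments-on-Q* : ∀ {t} → 1 < t → suc t < m → ¬ Attaches Q₁* t → ¬ Attaches Q₂* t →
    ∀ w → ¬ Adj G (c w) (walk p t)
  attachments-on-Q* {t} 1<t 1+t<m ¬A₁ ¬A₂ w w~t = classify (w ≟ a) (w ≟ b) (Between? a b w)
    where
    0<t : 0 < t
    0<t = <-trans 0<1+n 1<t
    t<m : t < m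
    t<m = <-trans (n<1+n t) 1+t<m
    classify : Dec (w ≡ a) → Dec (w ≡ b) → Dec (Between a b w) → ⊥
    classify (yes w≡a) _ _ =
      <⇒≢ 1<t (walk-induced 0<t (<⇒≤ t<m)
        (subst (λ x → Adj G x (walk p t)) (trans (cong c w≡a) (sym walk-start)) w~t))
    classify (no _) (yes w≡b) _ =
      <⇒≢ 1+t<m (walk-induced t<m ≤-refl
        (adj-sym G (subst (λ x → Adj G x (walk p t)) (trans (cong c w≡b) (sym walk-end)) w~t)))
    classify (no _) (no _) (yes w∈Q₁) = ¬A₁ (0<t , t<m , w , w∈Q₁ , w~t)
    classify (no w≢a) (no w≢b) (no w∉Q₁) = ¬A₂ (0<t , t<m , w , (w≢a , w≢b , w∉Q₁) , w~t)

  A₁? : ∀ t → Dec (Attaches Q₁* t)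
  A₁? = Attaches? (Between? a b)

  A₂? : ∀ t → Dec (Attaches Q₂* t)
  A₂? = Attaches? (InQ₂*? a b)

  Separated : (Fin k → Set) → (Fin k → Set) → Set
  Separated Q Q′ = ∀ {u v} → Q u → Q′ v → c u ≢ c v × ¬ Adj G (c u) (c v)

  Q₁*-Q₂*-separated : Separated Q₁* Q₂*
  Q₁*-Q₂*-separated u∈Q₁ (v≢a , v≢b , v∉Q₁) =
    (λ cu≡cv → v∉Q₁ (subst (Between a b) (IsHole.inj H cu≡cv) u∈Q₁)) ,
    (Q₁*-Q₂*-not-cyclically-adjacent a b u∈Q₁ (v≢a , v≢b , v∉Q₁) ∘ IsHole.induced H _ _)

  Q₂*-Q₁*-separated : Separated Q₂* Q₁*
  Q₂*-Q₁*-separated v∈Q₂ u∈Q₁ with Q₁*-Q₂*-separated u∈Q₁ v∈Q₂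
  ... | cu≢cv , cu≁cv = cu≢cv ∘ sym , cu≁cv ∘ adj-sym G

  shortJump-from-switch : ∀ {Q Q′} → Separated Q Q′ →
    (∀ {t} → 1 < t → suc t < m → ¬ Attaches Q t → ¬ Attaches Q′ t → ∀ w → ¬ Adj G (c w) (walk p t)) →
    Switch {Attaches Q} {Attaches Q′} → ShortJumpIn G c p
  shortJump-from-switch separated unattached
    (i , j , i<j , (0<i , i<m , u , u∈Q , u~i) , (0<j , j<m , v , v∈Q′ , v~j) , clear) =
    Detour.shortJumpIn G c (IsJump.path J) i D (subst (_≤ m) (sym i+D≡j) (<⇒≤ j<m)) u v
      (proj₁ (separated u∈Q v∈Q′)) (proj₂ (separated u∈Q v∈Q′))
      u~i (subst (λ t → Adj G (c v) (walk p t)) (sym i+D≡j) v~j) off attached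
    where
    D = j ∸ i
    i+D≡j : i + D ≡ j
    i+D≡j = m+[n∸m]≡n (<⇒≤ i<j)
    i+r<m : ∀ {r} → r ≤ D → i + r < m
    i+r<m r≤D = ≤-<-trans (≤-trans (+-monoʳ-≤ i r≤D) (≤-reflexive i+D≡j)) j<m
    off : ∀ {r} → r ≤ D → ∀ w → walk p (i + r) ≢ c w
    off r≤D = walk-internal-off-C (<-≤-trans 0<i (m≤m+n i _)) (i+r<m r≤D)
    attached : ∀ {r} → r ≤ D → ∀ w → Adj G (c w) (walk p (i + r)) → (r ≡ 0 × w ≡ u) ⊎ (r ≡ D × w ≡ v)
    attached {zero} _ w w~ =
      inj₁ (refl , unique-attachment 0<i i<m w u (subst (Adj G (c w) ∘ walk p) (+-identityʳ i) w~) u~i)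
    attached {suc r} r≤D w w~ with m≤n⇒m<n∨m≡n r≤D
    ... | inj₂ r≡D =
      inj₂ (r≡D , unique-attachment 0<j j<m w v (subst (Adj G (c w) ∘ walk p) (trans (cong (i +_) r≡D) i+D≡j) w~) v~j)
    ... | inj₁ r<D =
      contradiction w~ (unattached (+-mono-≤-< 0<i 0<1+n) (≤-<-trans i+r<j j<m) (proj₁ gap) (proj₂ gap) w)
      where
      i+r<j : i + suc r < j
      i+r<j = subst (i + suc r <_) i+D≡j (+-monoʳ-< i r<D)
      gap = clear (m<m+n i 0<1+n) i+r<j

  touches-both⇒shortJump : ∃ (Attaches Q₁*) → ∃ (Attaches Q₂*) → ShortJumpIn G c p
  touches-both⇒shortJump (s , A₁s) (t , A₂t) with <-cmp s t
  ... | tri< s<t _ _ =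
    shortJump-from-switch Q₁*-Q₂*-separated attachments-on-Q* (switch A₁? A₂? s<t A₁s A₂t)
  ... | tri> _ _ t<s =
    shortJump-from-switch Q₂*-Q₁*-separated (λ 1<r 1+r<m ¬A₂ ¬A₁ → attachments-on-Q* 1<r 1+r<m ¬A₁ ¬A₂)
      (switch A₂? A₁? t<s A₂t A₁s)
  ... | tri≈ _ refl _ with A₁s | A₂t
  ...   | 0<s , s<m , u , u∈Q₁ , u~s | _ , _ , v , v∈Q₂ , v~s =
    contradiction (cong c (unique-attachment 0<s s<m u v u~s v~s)) (proj₁ (Q₁*-Q₂*-separated u∈Q₁ v∈Q₂))

  nonLocal⇒shortJump : ¬ IsLocal G c a b m p → ShortJumpIn G c p
  nonLocal⇒shortJump nonLocal with Touches? (Between? a b) | Touches? (InQ₂*? a b)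
  ... | no ¬T₁ | no ¬T₂ = a , b , m , p , (J , ¬T₁ , ¬T₂) , λ i → inj₂ (i , refl)
  ... | yes T₁ | no ¬T₂ = contradiction (inj₁ (T₁ , ¬T₂)) nonLocal
  ... | no ¬T₁ | yes T₂ = contradiction (inj₂ (T₂ , ¬T₁)) nonLocal
  ... | yes T₁ | yes T₂ = touches-both⇒shortJump (touches⇒attaches T₁) (touches⇒attaches T₂)

odd-<2ℓ+3⇒≤2ℓ+1 : ∀ ℓ {k} → Odd k → ¬ 2 * ℓ + 3 ≤ k → k ≤ 2 * ℓ + 1
odd-<2ℓ+3⇒≤2ℓ+1 ℓ {k} (r , k≡1+2r) k≱2ℓ+3 with m≤n⇒m<n∨m≡n k≤2ℓ+2
  where
  k≤2ℓ+2 : k ≤ suc (2 * ℓ + 1)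
  k≤2ℓ+2 = ≤-pred (subst (suc k ≤_) (trans (+-suc (2 * ℓ) 2) (cong suc (+-suc (2 * ℓ) 1))) (≰⇒> k≱2ℓ+3))
... | inj₁ k<2ℓ+2 = ≤-pred k<2ℓ+2
... | inj₂ k≡2ℓ+2 =
  contradiction (suc-injective (trans (sym k≡1+2r) (trans k≡2ℓ+2 (cong suc (+-comm (2 * ℓ) 1))))) (even≢odd r ℓ)

module OddHoleOfGirthLength {n} {G : Graph n} {ℓ} (2≤ℓ : 2 ≤ ℓ) (girth : HasGirth G (2 * ℓ + 1))
  (noLongOddHole : ∀ k (c : Fin k → Fin n) → IsOddHole G k c → 2 * ℓ + 3 ≤ k → ⊥)
  {k} {c : Fin k → Fin n} (C : IsOddHole G k c) where

  length≡girth : k ≡ 2 * ℓ + 1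
  length≡girth = ≤-antisym (odd-<2ℓ+3⇒≤2ℓ+1 ℓ (proj₂ C) (noLongOddHole k c C))
    (≮⇒≥ λ k<girth → proj₂ girth k k<girth c (hole⇒cycle (proj₁ C)))

  5≤length : 5 ≤ k
  5≤length = subst (5 ≤_) (sym length≡girth) (+-monoˡ-≤ 1 (*-monoʳ-≤ 2 2≤ℓ))

  shortest : ∀ L → L < k → (f : Fin L → Fin n) → ¬ IsCycle G L f
  shortest L L<k = proj₂ girth L (subst (L <_) length≡girth L<k)

lemma4p2 : ∀ {n} (G : Graph n) (ℓ : ℕ) → 2 ≤ ℓ →
    HasGirth G (2 * ℓ + 1) →
    (∀ k (c : Fin k → Fin n) → IsOddHole G k c → 2 * ℓ + 3 ≤ k → ⊥) →
    ∀ k (c : Fin k → Fin n) → IsOddHole G k c →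
    ∀ (a b : Fin k) (m : ℕ) (p : Fin (suc m) → Fin n) →
    IsJump G c a b m p → ¬ IsLocal G c a b m p →
    ∃[ a' ] ∃[ b' ] ∃[ m' ] Σ (Fin (suc m') → Fin n) λ p' →
      IsShortJump G c a' b' m' p' × (∀ i → InCP c p (p' i))
lemma4p2 G ℓ 2≤ℓ girth noLongOddHole zero c (H , _) = contradiction (IsHole.length≥4 H) λ ()
-- Matching k with suc _ provides the NonZero instance needed to walk around C.
lemma4p2 G ℓ 2≤ℓ girth noLongOddHole (suc _) c C a b m p J nonLocal =
  NonLocalJump.nonLocal⇒shortJump G (proj₁ C) (unique-neighbour 5≤length shortest) J nonLocal
  where
  open OddHoleOfGirthLength 2≤ℓ girth noLongOddHole C
  open CycleWalk G (hole⇒cycle (proj₁ C)) using (unique-neighbour)
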